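{- Let $\underline{B}$ be a subordination algebra and $\varphi(p_1,\dots,p_n)$ a modal formula. Then $\underline{B}\models\varphi(\psi_1,\dots,\psi_n)$ for all modal formulas $\psi_1,\dots,\psi_n$ if and only if $\underline{B}^m\models\varphi(\psi_1,\dots,\psi_n)$ for all modal formulas $\psi_1,\dots,\psi_n$.
   Context: A subordination algebra is a pair $(B,\prec)$, $B$ a Boolean algebra, $\prec\subseteq B\times B$ with: $0\prec 0$, $1\prec 1$; $a\prec b,c\Rightarrow a\prec b\wedge c$; $b,c\prec a\Rightarrow b\vee c\prec a$; $a\le b\prec c\le d\Rightarrow a\prec d$. Its dual is $(X,R)$, $X$ the ultrafilter space of $B$, $r(b)=\{x: b\in x\}$, $xRy$ iff $\{b:\exists a\in y, a\prec b\}\subseteq x$. $\underline{B}^\delta=(\mathcal{P}(X),\lozenge)$ with $\lozenge E=\{x:\exists y\in E,\ xRy\}$; the modalisation $\underline{B}^m$ is the modal subalgebra of $\underline{B}^\delta$ generated by $r(B)$. Modal formulas are built from variables, $\top,\bot$ with Boolean connectives and $\lozenge$ ($\square=\neg\lozenge\neg$). $\underline{B}\models\varphi$ means: for every map $v$ from variables to $B$, the homomorphic extension of $p\mapsto r(v(p))$ to $(\mathcal{P}(X),\lozenge)$ sends $\varphi$ to $X$. For the modal algebra $\underline{B}^m$, $\models$ is usual validity (value $1$ under all valuations into $\underline{B}^m$). -}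

module Defs where

open import Level using (Level; _⊔_; Lift) renaming (suc to lsuc)
open import Algebra.Lattice.Bundles using (BooleanAlgebra)
open import Relation.Binary.Core using (Rel)
open import Data.Nat using (ℕ)
open import Data.Fin using (Fin)
open import Data.Product using (Σ; _×_; _,_; proj₁)
open import Data.Sum using (_⊎_)
open import Relation.Nullary using () renaming (¬_ to ¬ᵗ_)
open import Data.Unit.Polymorphic using () renaming (⊤ to Unit)
open import Data.Empty.Polymorphic using () renaming (⊥ to Empty)

infixr 6 _∧ᶠ_
infixr 5 _∨ᶠ_
infixr 4 _⇒ᶠ_

data Fm (V : Set) : Set where
  var  : V → Fm V
  ⊤ᶠ ⊥ᶠ : Fm V
  ¬ᶠ_  : Fm V → Fm V
  _∧ᶠ_ _∨ᶠ_ _⇒ᶠ_ : Fm V → Fm V → Fm V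
  ◇ᶠ_  : Fm V → Fm V

□ᶠ_ : {V : Set} → Fm V → Fm V
□ᶠ φ = ¬ᶠ (◇ᶠ (¬ᶠ φ))

subst : {V W : Set} → Fm V → (V → Fm W) → Fm W
subst (var x) σ = σ x
subst ⊤ᶠ σ = ⊤ᶠ
subst ⊥ᶠ σ = ⊥ᶠ
subst (¬ᶠ φ) σ = ¬ᶠ subst φ σ
subst (φ ∧ᶠ ψ) σ = subst φ σ ∧ᶠ subst ψ σ
subst (φ ∨ᶠ ψ) σ = subst φ σ ∨ᶠ subst ψ σ
subst (φ ⇒ᶠ ψ) σ = subst φ σ ⇒ᶠ subst ψ σ
subst (◇ᶠ φ) σ = ◇ᶠ subst φ σ

module _ {c ℓ : Level} (B : BooleanAlgebra c ℓ) where
  open BooleanAlgebra B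

  _≤_ : Rel Carrier ℓ
  a ≤ b = (a ∧ b) ≈ a

  record IsSubordination {ℓs : Level} (_≺_ : Rel Carrier ℓs) : Set (c ⊔ ℓ ⊔ ℓs) where
    field
      0≺0   : ⊥ ≺ ⊥
      1≺1   : ⊤ ≺ ⊤
      ≺-∧   : ∀ {a b d} → a ≺ b → a ≺ d → a ≺ (b ∧ d)
      ≺-∨   : ∀ {a b d} → b ≺ a → d ≺ a → (b ∨ d) ≺ a
      ≤≺≤   : ∀ {a b d e} → a ≤ b → b ≺ d → d ≤ e → a ≺ e

  record Ultrafilter : Set (lsuc (c ⊔ ℓ)) where
    field
      U      : Carrier → Set (c ⊔ ℓ)
      up     : ∀ {a b} → a ≤ b → U a → U b
      meet   : ∀ {a b} → U a → U b → U (a ∧ b)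
      top    : U ⊤
      proper : ¬ᵗ U ⊥
      ultra  : ∀ a → U a ⊎ U (¬ a)
  open Ultrafilter public

module Dual {c ℓ ℓs : Level} (B : BooleanAlgebra c ℓ) (_≺_ : Rel (BooleanAlgebra.Carrier B) ℓs) where
  open BooleanAlgebra B

  X : Set (lsuc (c ⊔ ℓ))
  X = Ultrafilter B

  L : Level
  L = lsuc (c ⊔ ℓ ⊔ ℓs)

  PX : Set (lsuc L)
  PX = X → Set L

  R : X → X → Set L
  R x y = ∀ b → Σ Carrier (λ a → U y a × (a ≺ b)) → Lift L (U x b)

  r : Carrier → PX
  r b x = Lift L (U x b)

  fullˢ emptyˢ : PX
  fullˢ _ = Unit
  emptyˢ _ = Empty

  compˢ : PX → PX
  compˢ E x = ¬ᵗ E x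

  _∩ˢ_ _∪ˢ_ _⇒ˢ_ : PX → PX → PX
  (E ∩ˢ F) x = E x × F x
  (E ∪ˢ F) x = E x ⊎ F x
  (E ⇒ˢ F) x = E x → F x

  ◇ˢ : PX → PX
  ◇ˢ E x = Σ X (λ y → R x y × E y)

  _≐_ : PX → PX → Set (lsuc (c ⊔ ℓ) ⊔ L)
  E ≐ F = (∀ x → E x → F x) × (∀ x → F x → E x)

  ⟦_⟧ : {V : Set} → Fm V → (V → PX) → PX
  ⟦ var p ⟧ v = v p
  ⟦ ⊤ᶠ ⟧ v = fullˢ
  ⟦ ⊥ᶠ ⟧ v = emptyˢ
  ⟦ ¬ᶠ φ ⟧ v = compˢ (⟦ φ ⟧ v)
  ⟦ φ ∧ᶠ ψ ⟧ v = ⟦ φ ⟧ v ∩ˢ ⟦ ψ ⟧ v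
  ⟦ φ ∨ᶠ ψ ⟧ v = ⟦ φ ⟧ v ∪ˢ ⟦ ψ ⟧ v
  ⟦ φ ⇒ᶠ ψ ⟧ v = ⟦ φ ⟧ v ⇒ˢ ⟦ ψ ⟧ v
  ⟦ ◇ᶠ φ ⟧ v = ◇ˢ (⟦ φ ⟧ v)

  ValidB : {V : Set} → Fm V → Set L
  ValidB {V} φ = (v : V → Carrier) → ∀ x → ⟦ φ ⟧ (λ p → r (v p)) x

  -- the carrier of B^m: the least subset of P(X) containing r(B) and
  -- closed under the operations of (P(X),◇) (up to equality of subsets)
  data InBm : PX → Set (lsuc L) where
    gen   : ∀ b → InBm (r b)
    full  : InBm fullˢ
    empty : InBm emptyˢ
    comp  : ∀ {E} → InBm E → InBm (compˢ E)
    cap   : ∀ {E F} → InBm E → InBm F → InBm (E ∩ˢ F)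
    cup   : ∀ {E F} → InBm E → InBm F → InBm (E ∪ˢ F)
    imp   : ∀ {E F} → InBm E → InBm F → InBm (E ⇒ˢ F)
    dia   : ∀ {E} → InBm E → InBm (◇ˢ E)
    resp  : ∀ {E F} → E ≐ F → InBm E → InBm F

  Bm : Set (lsuc L)
  Bm = Σ PX InBm

  ValidBm : {V : Set} → Fm V → Set (lsuc L)
  ValidBm {V} φ = (v : V → Bm) → ∀ x → ⟦ φ ⟧ (λ p → proj₁ (v p)) x

module Submission where

open import Defs
open import Level using (Level)
open import Algebra.Lattice.Bundles using (BooleanAlgebra)
open import Relation.Binary.Core using (Rel)
open import Data.Nat using (ℕ; zero; suc)
open import Data.Fin using (Fin)
import Data.Fin as Fin
open import Data.Product using (_×_; Σ-syntax; _,_; proj₁; proj₂)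
open import Data.Sum using (_⊎_; inj₁; inj₂; [_,_]′)
open import Data.Unit using (⊤; tt)
open import Function using (_∘_)
open import Relation.Binary.PropositionalEquality using (_≡_; refl)

-- Every element of B^m is the value of some formula under a valuation into
-- r(B), and finitely many elements can be reached with a single valuation by
-- interleaving variables.  Hence an instance φ(ψ) under a valuation into B^m
-- has the same value as an instance φ(χ) under a valuation into B, and
-- conversely r(B) ⊆ B^m.

rename : {V W : Set} → (V → W) → Fm V → Fm W
rename f χ = subst χ (var ∘ f)

double : ℕ → ℕ
double zero = zero
double (suc k) = suc (suc (double k))

interleave : {a : Level} {A : Set a} → (ℕ → A) → (ℕ → A) → ℕ → A
interleave u v zero = u zero
interleave u v (suc p) = interleave v (u ∘ suc) p

interleave-double : {a : Level} {A : Set a} (u v : ℕ → A) (k : ℕ) → interleave u v (double k) ≡ u k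
interleave-double u v zero = refl
interleave-double u v (suc k) = interleave-double (u ∘ suc) (v ∘ suc) k

interleave-suc-double : {a : Level} {A : Set a} (u v : ℕ → A) (k : ℕ) → interleave u v (suc (double k)) ≡ v k
interleave-suc-double u v = interleave-double v (u ∘ suc)

module Modalisation {c ℓ ℓs : Level} (B : BooleanAlgebra c ℓ)
    (_≺_ : Rel (BooleanAlgebra.Carrier B) ℓs) where
  open BooleanAlgebra B using (Carrier)
  open Dual B _≺_

  ≐-refl : ∀ {E} → E ≐ E
  ≐-refl = (λ _ e → e) , (λ _ e → e)

  ≐-sym : ∀ {E F} → E ≐ F → F ≐ E
  ≐-sym (to , from) = from , to

  ≐-trans : ∀ {E F G} → E ≐ F → F ≐ G → E ≐ G
  ≐-trans (to , from) (to′ , from′) = (λ x → to′ x ∘ to x) , (λ x → from x ∘ from′ x)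

  compˢ-cong : ∀ {E F} → E ≐ F → compˢ E ≐ compˢ F
  compˢ-cong (to , from) = (λ x ¬e → ¬e ∘ from x) , (λ x ¬f → ¬f ∘ to x)

  ∩ˢ-cong : ∀ {E F E′ F′} → E ≐ E′ → F ≐ F′ → (E ∩ˢ F) ≐ (E′ ∩ˢ F′)
  ∩ˢ-cong (to , from) (to′ , from′) =
    (λ { x (e , f) → to x e , to′ x f }) , (λ { x (e , f) → from x e , from′ x f })

  ∪ˢ-cong : ∀ {E F E′ F′} → E ≐ E′ → F ≐ F′ → (E ∪ˢ F) ≐ (E′ ∪ˢ F′)
  ∪ˢ-cong (to , from) (to′ , from′) =
    (λ { x (inj₁ e) → inj₁ (to x e) ; x (inj₂ f) → inj₂ (to′ x f) }) ,
    (λ { x (inj₁ e) → inj₁ (from x e) ; x (inj₂ f) → inj₂ (from′ x f) })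

  ⇒ˢ-cong : ∀ {E F E′ F′} → E ≐ E′ → F ≐ F′ → (E ⇒ˢ F) ≐ (E′ ⇒ˢ F′)
  ⇒ˢ-cong (to , from) (to′ , from′) =
    (λ x h → to′ x ∘ h ∘ from x) , (λ x h → from′ x ∘ h ∘ to x)

  ◇ˢ-cong : ∀ {E F} → E ≐ F → ◇ˢ E ≐ ◇ˢ F
  ◇ˢ-cong (to , from) =
    (λ { x (y , xRy , e) → y , xRy , to y e }) , (λ { x (y , xRy , f) → y , xRy , from y f })

  ⟦⟧-cong : {V : Set} (φ : Fm V) {v v′ : V → PX} → (∀ p → v p ≐ v′ p) → ⟦ φ ⟧ v ≐ ⟦ φ ⟧ v′
  ⟦⟧-cong (var p) v≐v′ = v≐v′ p
  ⟦⟧-cong ⊤ᶠ v≐v′ = ≐-refl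
  ⟦⟧-cong ⊥ᶠ v≐v′ = ≐-refl
  ⟦⟧-cong (¬ᶠ φ) v≐v′ = compˢ-cong (⟦⟧-cong φ v≐v′)
  ⟦⟧-cong (φ ∧ᶠ ψ) v≐v′ = ∩ˢ-cong (⟦⟧-cong φ v≐v′) (⟦⟧-cong ψ v≐v′)
  ⟦⟧-cong (φ ∨ᶠ ψ) v≐v′ = ∪ˢ-cong (⟦⟧-cong φ v≐v′) (⟦⟧-cong ψ v≐v′)
  ⟦⟧-cong (φ ⇒ᶠ ψ) v≐v′ = ⇒ˢ-cong (⟦⟧-cong φ v≐v′) (⟦⟧-cong ψ v≐v′)
  ⟦⟧-cong (◇ᶠ φ) v≐v′ = ◇ˢ-cong (⟦⟧-cong φ v≐v′)

  ⟦subst⟧ : {V W : Set} (φ : Fm V) (σ : V → Fm W) (v : W → PX) →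
            ⟦ subst φ σ ⟧ v ≐ ⟦ φ ⟧ (λ p → ⟦ σ p ⟧ v)
  ⟦subst⟧ (var p) σ v = ≐-refl
  ⟦subst⟧ ⊤ᶠ σ v = ≐-refl
  ⟦subst⟧ ⊥ᶠ σ v = ≐-refl
  ⟦subst⟧ (¬ᶠ φ) σ v = compˢ-cong (⟦subst⟧ φ σ v)
  ⟦subst⟧ (φ ∧ᶠ ψ) σ v = ∩ˢ-cong (⟦subst⟧ φ σ v) (⟦subst⟧ ψ σ v)
  ⟦subst⟧ (φ ∨ᶠ ψ) σ v = ∪ˢ-cong (⟦subst⟧ φ σ v) (⟦subst⟧ ψ σ v)
  ⟦subst⟧ (φ ⇒ᶠ ψ) σ v = ⇒ˢ-cong (⟦subst⟧ φ σ v) (⟦subst⟧ ψ σ v)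
  ⟦subst⟧ (◇ᶠ φ) σ v = ◇ˢ-cong (⟦subst⟧ φ σ v)

  ⟦⟧-InBm : {V : Set} (φ : Fm V) (v : V → PX) → (∀ p → InBm (v p)) → InBm (⟦ φ ⟧ v)
  ⟦⟧-InBm (var p) v v∈Bm = v∈Bm p
  ⟦⟧-InBm ⊤ᶠ v v∈Bm = full
  ⟦⟧-InBm ⊥ᶠ v v∈Bm = empty
  ⟦⟧-InBm (¬ᶠ φ) v v∈Bm = comp (⟦⟧-InBm φ v v∈Bm)
  ⟦⟧-InBm (φ ∧ᶠ ψ) v v∈Bm = cap (⟦⟧-InBm φ v v∈Bm) (⟦⟧-InBm ψ v v∈Bm)
  ⟦⟧-InBm (φ ∨ᶠ ψ) v v∈Bm = cup (⟦⟧-InBm φ v v∈Bm) (⟦⟧-InBm ψ v v∈Bm)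
  ⟦⟧-InBm (φ ⇒ᶠ ψ) v v∈Bm = imp (⟦⟧-InBm φ v v∈Bm) (⟦⟧-InBm ψ v v∈Bm)
  ⟦⟧-InBm (◇ᶠ φ) v v∈Bm = dia (⟦⟧-InBm φ v v∈Bm)

  ⟦rename⟧ : (χ : Fm ℕ) (f : ℕ → ℕ) {w w′ : ℕ → Carrier} → (∀ p → w′ (f p) ≡ w p) →
             ⟦ rename f χ ⟧ (r ∘ w′) ≐ ⟦ χ ⟧ (r ∘ w)
  ⟦rename⟧ χ f w′∘f≡w = ≐-trans (⟦subst⟧ χ (var ∘ f) _) (⟦⟧-cong χ (r-cong ∘ w′∘f≡w))
    where
    r-cong : ∀ {a b} → a ≡ b → r a ≐ r b
    r-cong refl = ≐-refl

  Definable : {I : Set} → (I → PX) → Set L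
  Definable {I} E = Σ[ χ ∈ (I → Fm ℕ) ] Σ[ w ∈ (ℕ → Carrier) ] ∀ i → ⟦ χ i ⟧ (r ∘ w) ≐ E i

  Definable-⊎ : {I J : Set} {E : I → PX} {F : J → PX} →
                Definable E → Definable F → Definable [ E , F ]′
  Definable-⊎ (χ , u , χ≐E) (χ′ , v , χ′≐F) =
      [ rename double ∘ χ , rename (suc ∘ double) ∘ χ′ ]′ , interleave u v ,
      λ { (inj₁ i) → ≐-trans (⟦rename⟧ (χ i) double (interleave-double u v)) (χ≐E i)
        ; (inj₂ j) → ≐-trans (⟦rename⟧ (χ′ j) (suc ∘ double) (interleave-suc-double u v)) (χ′≐F j) }

  Definable-≐ : {I : Set} {E F : I → PX} → (∀ i → E i ≐ F i) → Definable E → Definable F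
  Definable-≐ E≐F (χ , w , χ≐E) = χ , w , λ i → ≐-trans (χ≐E i) (E≐F i)

  InBm⇒Definable : ∀ {E} → InBm E → Definable {⊤} (λ _ → E)
  InBm⇒Definable (gen b) = (λ _ → var zero) , (λ _ → b) , (λ _ → ≐-refl)
  InBm⇒Definable full = (λ _ → ⊤ᶠ) , (λ _ → BooleanAlgebra.⊤ B) , (λ _ → ≐-refl)
  InBm⇒Definable empty = (λ _ → ⊥ᶠ) , (λ _ → BooleanAlgebra.⊤ B) , (λ _ → ≐-refl)
  InBm⇒Definable (comp E) with InBm⇒Definable E
  ... | χ , w , χ≐E = (λ _ → ¬ᶠ χ tt) , w , (λ _ → compˢ-cong (χ≐E tt))
  InBm⇒Definable (dia E) with InBm⇒Definable E
  ... | χ , w , χ≐E = (λ _ → ◇ᶠ χ tt) , w , (λ _ → ◇ˢ-cong (χ≐E tt))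
  InBm⇒Definable (resp E≐F E) = Definable-≐ (λ _ → E≐F) (InBm⇒Definable E)
  InBm⇒Definable (cap E F) with Definable-⊎ (InBm⇒Definable E) (InBm⇒Definable F)
  ... | χ , w , χ≐ = (λ _ → χ (inj₁ tt) ∧ᶠ χ (inj₂ tt)) , w ,
                     (λ _ → ∩ˢ-cong (χ≐ (inj₁ tt)) (χ≐ (inj₂ tt)))
  InBm⇒Definable (cup E F) with Definable-⊎ (InBm⇒Definable E) (InBm⇒Definable F)
  ... | χ , w , χ≐ = (λ _ → χ (inj₁ tt) ∨ᶠ χ (inj₂ tt)) , w ,
                     (λ _ → ∪ˢ-cong (χ≐ (inj₁ tt)) (χ≐ (inj₂ tt)))
  InBm⇒Definable (imp E F) with Definable-⊎ (InBm⇒Definable E) (InBm⇒Definable F)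
  ... | χ , w , χ≐ = (λ _ → χ (inj₁ tt) ⇒ᶠ χ (inj₂ tt)) , w ,
                     (λ _ → ⇒ˢ-cong (χ≐ (inj₁ tt)) (χ≐ (inj₂ tt)))

  InBm⇒Definable-Fin : (n : ℕ) {E : Fin n → PX} → (∀ i → InBm (E i)) → Definable E
  InBm⇒Definable-Fin zero E∈Bm = (λ ()) , (λ _ → BooleanAlgebra.⊤ B) , (λ ())
  InBm⇒Definable-Fin (suc n) E∈Bm
    with Definable-⊎ (InBm⇒Definable (E∈Bm Fin.zero)) (InBm⇒Definable-Fin n (E∈Bm ∘ Fin.suc))
  ... | χ , w , χ≐ = (λ { Fin.zero → χ (inj₁ tt) ; (Fin.suc i) → χ (inj₂ i) }) , w ,
                     (λ { Fin.zero → χ≐ (inj₁ tt) ; (Fin.suc i) → χ≐ (inj₂ i) })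

  ValidB-instances⇒ValidBm : {n : ℕ} (φ : Fm (Fin n)) →
    ((χ : Fin n → Fm ℕ) → ValidB (subst φ χ)) → (ψ : Fin n → Fm ℕ) → ValidBm (subst φ ψ)
  ValidB-instances⇒ValidBm {n} φ valid ψ v x
    with InBm⇒Definable-Fin n (λ i → ⟦⟧-InBm (ψ i) (proj₁ ∘ v) (proj₂ ∘ v))
  ... | χ , w , χ≐ψ = proj₁ φ[χ]≐φ[ψ] x (valid χ w x)
    where
    φ[χ]≐φ[ψ] : ⟦ subst φ χ ⟧ (r ∘ w) ≐ ⟦ subst φ ψ ⟧ (proj₁ ∘ v)
    φ[χ]≐φ[ψ] = ≐-trans (⟦subst⟧ φ χ (r ∘ w))
                  (≐-trans (⟦⟧-cong φ χ≐ψ) (≐-sym (⟦subst⟧ φ ψ (proj₁ ∘ v))))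

  ValidBm⇒ValidB : {V : Set} (φ : Fm V) → ValidBm φ → ValidB φ
  ValidBm⇒ValidB φ valid v = valid (λ p → r (v p) , gen (v p))

proposition2p9 : {c ℓ ℓs : Level} (B : BooleanAlgebra c ℓ)
    (_≺_ : Rel (BooleanAlgebra.Carrier B) ℓs) → IsSubordination B _≺_ →
    (n : ℕ) (φ : Fm (Fin n)) →
    (((ψ : Fin n → Fm ℕ) → Dual.ValidB B _≺_ (subst φ ψ)) →
      ((ψ : Fin n → Fm ℕ) → Dual.ValidBm B _≺_ (subst φ ψ)))
    × (((ψ : Fin n → Fm ℕ) → Dual.ValidBm B _≺_ (subst φ ψ)) →
      ((ψ : Fin n → Fm ℕ) → Dual.ValidB B _≺_ (subst φ ψ)))
proposition2p9 B _≺_ _ n φ =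
  ValidB-instances⇒ValidBm φ , λ valid ψ → ValidBm⇒ValidB (subst φ ψ) (valid ψ)
  where open Modalisation B _≺_
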